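{- Let $m\ge 2$ be even and $n\ge1$ arbitrary. Let $\mathbf{r}=(r_1,\dots,r_{m-1})\in\mathbb{Z}^{m-1}$ and $\mathbf{r}^+=(r_1,\dots,r_{m-1},-\sum_{i=1}^{m-1}r_i)\in\mathbb{Z}^m$. Then there is a bijection between $A_{\mathbf{r}}(m-1,n)$ and $A_{\mathbf{r}^+}(m,n)$; in particular $\alpha_{\mathbf{r}}(m-1,n)=\alpha_{\mathbf{r}^+}(m,n)$.
   Context: A $\pm1$ matrix is one with all entries in $\{1,-1\}$. For a $k\times n$ $\pm1$ matrix, its row-sum vector is $(r_1,\dots,r_k)$ where $r_i$ is the sum of row $i$. A $\pm1$ matrix is column-good if every column sum lies in $\{ -1,0,1\}$. For $\mathbf{r}\in\mathbb{Z}^k$, $A_{\mathbf{r}}(k,n)$ is the set of column-good $k\times n$ $\pm1$ matrices with row-sum vector $\mathbf{r}$, and $\alpha_{\mathbf{r}}(k,n)=|A_{\mathbf{r}}(k,n)|$. -}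

module Defs where

open import Data.Nat using (ℕ; zero; suc)
open import Data.Integer using (ℤ; +_; -_; _+_; _-_; 0ℤ; 1ℤ; -1ℤ)
open import Data.Fin using (Fin)
open import Data.Vec using (Vec; []; _∷_; map; foldr; replicate; zipWith; _∷ʳ_; transpose)
open import Data.List using (List; length; filter)
open import Data.List.Relation.Unary.All using (All)
open import Data.Product using (Σ; _×_; _,_)
open import Data.Bool using (Bool; true; false)
open import Relation.Binary.PropositionalEquality using (_≡_)
open import Relation.Nullary using (Dec; yes; no)

data Sign : Set where
  plus minus : Sign

val : Sign → ℤ
val plus  = 1ℤ
val minus = -1ℤ

Matrix : ℕ → ℕ → Set
Matrix k n = Vec (Vec Sign n) k

sumℤ : ∀ {n} → Vec ℤ n → ℤ
sumℤ = foldr _ _+_ 0ℤ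

rowSum : ∀ {n} → Vec Sign n → ℤ
rowSum v = sumℤ (map val v)

rowSums : ∀ {k n} → Matrix k n → Vec ℤ k
rowSums = map rowSum

colSums : ∀ {k n} → Matrix k n → Vec ℤ n
colSums {k} {n} M = map rowSum (transpose M)

data InSmall : ℤ → Set where
  is-1 : InSmall -1ℤ
  is0  : InSmall 0ℤ
  is1  : InSmall 1ℤ

open import Data.Vec.Relation.Unary.All as VAll using ()

ColumnGood : ∀ {k n} → Matrix k n → Set
ColumnGood M = VAll.All InSmall (colSums M)

A : ∀ {k} → Vec ℤ k → ℕ → Set
A {k} r n = Σ (Matrix k n) (λ M → rowSums M ≡ r × ColumnGood M)

extend : ∀ {k} → Vec ℤ k → Vec ℤ (suc k)
extend r = r ∷ʳ (- sumℤ r)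

allVecs : (n : ℕ) → List (Vec Sign n)
allVecs zero = [] Data.List.∷ Data.List.[]
allVecs (suc n) = Data.List.concatMap (λ v → Data.List.map (_∷ v) (plus Data.List.∷ minus Data.List.∷ Data.List.[])) (allVecs n)

allMatrices : (k n : ℕ) → List (Matrix k n)
allMatrices zero n = [] Data.List.∷ Data.List.[]
allMatrices (suc k) n = Data.List.concatMap (λ M → Data.List.map (_∷ M) (allVecs n)) (allMatrices k n)

_≟s_ : (a b : Sign) → Dec (a ≡ b)
plus ≟s plus = yes _≡_.refl
plus ≟s minus = no (λ ())
minus ≟s plus = no (λ ())
minus ≟s minus = yes _≡_.refl

inSmall? : (z : ℤ) → Dec (InSmall z)
inSmall? z with z Data.Integer.≟ -1ℤ | z Data.Integer.≟ 0ℤ | z Data.Integer.≟ 1ℤ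
... | yes _≡_.refl | _ | _ = yes is-1
... | no _ | yes _≡_.refl | _ = yes is0
... | no _ | no _ | yes _≡_.refl = yes is1
... | no a | no b | no c = no (λ { is-1 → a _≡_.refl ; is0 → b _≡_.refl ; is1 → c _≡_.refl })

open import Data.Vec.Properties using (≡-dec)
open import Relation.Nullary.Decidable using (_×-dec_)

inA? : ∀ {k n} (r : Vec ℤ k) (M : Matrix k n) → Dec (rowSums M ≡ r × ColumnGood M)
inA? r M = ≡-dec Data.Integer._≟_ (rowSums M) r ×-dec VAll.all? inSmall? (colSums M)

α : ∀ {k} → Vec ℤ k → ℕ → ℕ
α r n = length (filter (inA? r) (allMatrices _ n))

module Submission where

-- Let k = m - 1 be odd.  Every column sum of a k×n ±1 matrix
-- has the parity of k, so a column-good M has all column sums in {-1, 1}.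
-- Appending the row that negates each column sum ("completing" M) gives a
-- (k+1)×n matrix whose column sums all vanish; by double counting
-- (sum of row sums = sum of column sums) the new row sums to -(r₁+⋯+r_k).
-- Conversely, in a column-good (k+1)×n matrix every column sum is even,
-- hence 0, so the last row is forced to be the negation of the column sums
-- of the first k rows: deleting the last row inverts the completion.

open import Defs
open import Data.Nat using (ℕ; suc; _≥_; _*_)
open import Data.Integer using (ℤ)
open import Data.Vec using (Vec)
open import Data.Product using (Σ; _×_)
open import Function.Bundles using (_⤖_)
open import Relation.Binary.PropositionalEquality using (_≡_)

open import Data.Nat using (zero)
import Data.Nat.Properties as ℕP
open import Data.Integer using (+_; -[1+_]; 0ℤ; ∣_∣; -_; _+_)
import Data.Integer.Properties as ℤP
open import Data.Bool using (Bool; true; false; not)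
open import Data.Bool.Properties using (not-involutive)
open import Data.Vec using ([]; _∷_; _∷ʳ_; map; zipWith; replicate; transpose; _⊛_; init; last; initLast)
import Data.Vec.Properties as VP
open import Data.Vec.Relation.Binary.Pointwise.Inductive as Pointwise using (Pointwise-≡⇒≡)
open import Data.Vec.Relation.Unary.All as VAll using ([]; _∷_)
open import Data.List as L using (List; length; filter)
import Data.List.Relation.Unary.Any as Any
import Data.List.Relation.Unary.All as LAll
open import Data.List.Relation.Unary.AllPairs using ([]; _∷_)
open import Data.List.Relation.Unary.Unique.Propositional using (Unique)
import Data.List.Relation.Unary.Unique.Propositional.Properties as Unique
open import Data.List.Membership.Propositional using (_∈_)
import Data.List.Membership.Propositional.Properties as ∈
open import Data.List.Membership.Propositional.Properties.WithK using (unique∧set⇒bag)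
open import Data.List.Relation.Binary.BagAndSetEquality using (_∼[_]_; bag; ∼bag⇒↭)
open import Data.List.Relation.Binary.Permutation.Propositional.Properties using (↭-length)
import Data.List.Properties as LP
open import Data.Product using (∃; _,_; proj₁; proj₂)
open import Function.Bundles using (mk↔ₛ′; mk⇔)
open import Function.Definitions using (Injective)
open import Function.Properties.Inverse using (↔⇒⤖)
open import Relation.Unary using (Decidable)
open import Relation.Binary.PropositionalEquality using (refl; sym; trans; cong; cong₂; subst; module ≡-Reasoning)
open import Relation.Binary.PropositionalEquality.WithK using (≡-irrelevant)
open import Algebra.Properties.CommutativeSemigroup ℤP.+-commutativeSemigroup using (interchange)
open import Algebra.Properties.AbelianGroup ℤP.+-0-abelianGroup using (inverseˡ-unique)

infixl 6 _⊕_
_⊕_ : ∀ {n} → Vec ℤ n → Vec ℤ n → Vec ℤ n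
_⊕_ = zipWith _+_

⊕-identityˡ : ∀ {n} (v : Vec ℤ n) → replicate n 0ℤ ⊕ v ≡ v
⊕-identityˡ v = Pointwise-≡⇒≡ (Pointwise.zipWith-identityˡ ℤP.+-identityˡ v)

⊕-identityʳ : ∀ {n} (v : Vec ℤ n) → v ⊕ replicate n 0ℤ ≡ v
⊕-identityʳ v = Pointwise-≡⇒≡ (Pointwise.zipWith-identityʳ ℤP.+-identityʳ v)

⊕-assoc : ∀ {n} (u v w : Vec ℤ n) → u ⊕ (v ⊕ w) ≡ (u ⊕ v) ⊕ w
⊕-assoc u v w = sym (Pointwise-≡⇒≡ (Pointwise.zipWith-assoc ℤP.+-assoc u v w))

⊕-inverseʳ : ∀ {n} (v : Vec ℤ n) → v ⊕ map -_ v ≡ replicate n 0ℤ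
⊕-inverseʳ []      = refl
⊕-inverseʳ (a ∷ v) = cong₂ _∷_ (ℤP.+-inverseʳ a) (⊕-inverseʳ v)

sum-⊕ : ∀ {n} (u v : Vec ℤ n) → sumℤ (u ⊕ v) ≡ sumℤ u + sumℤ v
sum-⊕ []      []      = refl
sum-⊕ (a ∷ u) (b ∷ v) =
  trans (cong (λ t → (a + b) + t) (sum-⊕ u v)) (interchange a b (sumℤ u) (sumℤ v))

sum-replicate-0 : ∀ n → sumℤ (replicate n 0ℤ) ≡ 0ℤ
sum-replicate-0 zero    = refl
sum-replicate-0 (suc n) = trans (ℤP.+-identityˡ _) (sum-replicate-0 n)

sum-neg : ∀ {n} (v : Vec ℤ n) → sumℤ (map -_ v) ≡ - sumℤ v
sum-neg []      = refl
sum-neg (a ∷ v) = trans (cong (λ t → - a + t) (sum-neg v)) (sym (ℤP.neg-distrib-+ a (sumℤ v)))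

all-replicate : ∀ {P : ℤ → Set} {x} n → P x → VAll.All P (replicate n x)
all-replicate zero    px = []
all-replicate (suc n) px = px ∷ all-replicate n px

colSums-[] : ∀ n → colSums {0} {n} [] ≡ replicate n 0ℤ
colSums-[] zero    = refl
colSums-[] (suc n) = cong (0ℤ ∷_) (colSums-[] n)

colSums-∷ : ∀ {k n} (x : Vec Sign n) (M : Matrix k n) →
  colSums (x ∷ M) ≡ map val x ⊕ colSums M
colSums-∷ x M = prepend-rowSums x (transpose M)
  where
  -- transpose (x ∷ M) prepends the entries of x to the columns of M
  prepend-rowSums : ∀ {m n} (x : Vec Sign n) (T : Vec (Vec Sign m) n) →
    map rowSum ((replicate n _∷_ ⊛ x) ⊛ T) ≡ map val x ⊕ map rowSum T
  prepend-rowSums []      []      = refl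
  prepend-rowSums (s ∷ x) (t ∷ T) = cong (val s + rowSum t ∷_) (prepend-rowSums x T)

colSums-∷ʳ : ∀ {k n} (M : Matrix k n) (w : Vec Sign n) →
  colSums (M ∷ʳ w) ≡ colSums M ⊕ map val w
colSums-∷ʳ {n = n} [] w = begin
  colSums (w ∷ [])                        ≡⟨ colSums-∷ w [] ⟩
  map val w ⊕ colSums {0} []              ≡⟨ cong (map val w ⊕_) (colSums-[] n) ⟩
  map val w ⊕ replicate n 0ℤ              ≡⟨ ⊕-identityʳ (map val w) ⟩
  map val w                               ≡⟨ sym (⊕-identityˡ (map val w)) ⟩
  replicate n 0ℤ ⊕ map val w              ≡⟨ cong (_⊕ map val w) (sym (colSums-[] n)) ⟩
  colSums {0} [] ⊕ map val w              ∎
  where open ≡-Reasoning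
colSums-∷ʳ (x ∷ M) w = begin
  colSums (x ∷ (M ∷ʳ w))                  ≡⟨ colSums-∷ x (M ∷ʳ w) ⟩
  map val x ⊕ colSums (M ∷ʳ w)            ≡⟨ cong (map val x ⊕_) (colSums-∷ʳ M w) ⟩
  map val x ⊕ (colSums M ⊕ map val w)     ≡⟨ ⊕-assoc (map val x) (colSums M) (map val w) ⟩
  (map val x ⊕ colSums M) ⊕ map val w     ≡⟨ cong (_⊕ map val w) (sym (colSums-∷ x M)) ⟩
  colSums (x ∷ M) ⊕ map val w             ∎
  where open ≡-Reasoning

double-counting : ∀ {k n} (M : Matrix k n) → sumℤ (rowSums M) ≡ sumℤ (colSums M)
double-counting {n = n} [] = sym (trans (cong sumℤ (colSums-[] n)) (sum-replicate-0 n))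
double-counting (x ∷ M) = begin
  rowSum x + sumℤ (rowSums M)             ≡⟨ cong (λ t → rowSum x + t) (double-counting M) ⟩
  sumℤ (map val x) + sumℤ (colSums M)     ≡⟨ sym (sum-⊕ (map val x) (colSums M)) ⟩
  sumℤ (map val x ⊕ colSums M)            ≡⟨ cong sumℤ (sym (colSums-∷ x M)) ⟩
  sumℤ (colSums (x ∷ M))                  ∎
  where open ≡-Reasoning

odd : ℕ → Bool
odd zero    = false
odd (suc n) = not (odd n)

oddℤ : ℤ → Bool
oddℤ z = odd ∣ z ∣

odd-double : ∀ j → odd (2 * j) ≡ false
odd-double zero    = refl
odd-double (suc j) = trans (cong odd (ℕP.*-suc 2 j)) (trans (not-involutive _) (odd-double j))

oddℤ-flip : ∀ s z → oddℤ (val s + z) ≡ not (oddℤ z)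
oddℤ-flip plus  (+ n)            = refl
oddℤ-flip plus  -[1+ zero ]      = refl
oddℤ-flip plus  -[1+ suc m ]     = sym (not-involutive _)
oddℤ-flip minus (+ zero)         = refl
oddℤ-flip minus (+ suc m)        = sym (not-involutive _)
oddℤ-flip minus -[1+ m ]         = refl

colSums-parity : ∀ {k n} (M : Matrix k n) → VAll.All (λ c → oddℤ c ≡ odd k) (colSums M)
colSums-parity {n = n} [] = subst (VAll.All _) (sym (colSums-[] n)) (all-replicate n refl)
colSums-parity (x ∷ M) = subst (VAll.All _) (sym (colSums-∷ x M)) (add-row x (colSums-parity M))
  where
  add-row : ∀ {n b} (x : Vec Sign n) {cs : Vec ℤ n} → VAll.All (λ c → oddℤ c ≡ b) cs →
    VAll.All (λ c → oddℤ c ≡ not b) (map val x ⊕ cs)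
  add-row []      []       = []
  add-row (s ∷ x) (p ∷ ps) = trans (oddℤ-flip s _) (cong not p) ∷ add-row x ps

small-even-zero : ∀ {z} → InSmall z → oddℤ z ≡ false → z ≡ 0ℤ
small-even-zero is0 _ = refl

balance : ℤ → Sign
balance (+ suc zero) = minus
balance _            = plus

balance-negates : ∀ {c} → InSmall c → oddℤ c ≡ true → val (balance c) ≡ - c
balance-negates is-1 _ = refl
balance-negates is1  _ = refl

balance-recovers : ∀ c s → c + val s ≡ 0ℤ → InSmall c × balance c ≡ s
balance-recovers c s eq with inverseˡ-unique c (val s) eq
balance-recovers _ plus  _ | refl = is-1 , refl
balance-recovers _ minus _ | refl = is1  , refl

complete : ∀ {k n} → Matrix k n → Matrix (suc k) n
complete M = M ∷ʳ map balance (colSums M)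

complete-injective : ∀ {k n} → Injective _≡_ _≡_ (complete {k} {n})
complete-injective {x = M} {M′} = VP.∷ʳ-injectiveˡ M M′

-- For an odd number of rows, completion maps A_r into A_{r⁺}: the new row
-- negates the column sums, so all new column sums vanish, and its sum is
-- minus the total of M, i.e. -(r₁+⋯+r_k).
complete-good : ∀ {k n} (r : Vec ℤ k) → odd k ≡ true → (M : Matrix k n) →
  rowSums M ≡ r × ColumnGood M → rowSums (complete M) ≡ extend r × ColumnGood (complete M)
complete-good {n = n} r k-odd M (rows , good) = rows′ , good′
  where
  cs : Vec ℤ n
  cs = colSums M
  w : Vec Sign n
  w = map balance cs
  new-row : map val w ≡ map -_ cs
  new-row = trans (sym (VP.map-∘ val balance cs)) (negates good (VAll.map (λ e → trans e k-odd) (colSums-parity M)))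
    where
    negates : ∀ {n} {cs : Vec ℤ n} → VAll.All InSmall cs → VAll.All (λ c → oddℤ c ≡ true) cs →
      map (λ c → val (balance c)) cs ≡ map -_ cs
    negates []       []       = refl
    negates (s ∷ ss) (o ∷ os) = cong₂ _∷_ (balance-negates s o) (negates ss os)
  new-row-sum : rowSum w ≡ - sumℤ r
  new-row-sum = begin
    sumℤ (map val w)          ≡⟨ cong sumℤ new-row ⟩
    sumℤ (map -_ cs)          ≡⟨ sum-neg cs ⟩
    - sumℤ cs                 ≡⟨ cong -_ (sym (double-counting M)) ⟩
    - sumℤ (rowSums M)        ≡⟨ cong (λ v → - sumℤ v) rows ⟩
    - sumℤ r                  ∎
    where open ≡-Reasoning
  rows′ : rowSums (complete M) ≡ extend r
  rows′ = trans (VP.map-∷ʳ rowSum w M) (cong₂ _∷ʳ_ rows new-row-sum)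
  good′ : ColumnGood (complete M)
  good′ = subst (VAll.All InSmall)
    (sym (trans (colSums-∷ʳ M w) (trans (cong (cs ⊕_) new-row) (⊕-inverseʳ cs))))
    (all-replicate n is0)

-- For an even number k+1 of rows, a matrix of A_{r⁺} is the completion of
-- its first k rows, which lie in A_r: all its column sums are even, hence
-- 0, so the last row is forced.
uncomplete-good : ∀ {k n} (r : Vec ℤ k) → odd (suc k) ≡ false → (M : Matrix (suc k) n) →
  rowSums M ≡ extend r → ColumnGood M →
  (rowSums (init M) ≡ r × ColumnGood (init M)) × complete (init M) ≡ M
uncomplete-good r rows-even M rows good with init M | last M | proj₂ (proj₂ (initLast M))
... | I | L | refl = (rows-I , good-I) , cong (I ∷ʳ_) last-forced
  where
  zero-sums : VAll.All (_≡ 0ℤ) (colSums I ⊕ map val L)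
  zero-sums = subst (VAll.All _) (colSums-∷ʳ I L)
    (VAll.map (λ (s , e) → small-even-zero s (trans e rows-even)) (VAll.zip (good , colSums-parity (I ∷ʳ L))))
  recover : ∀ {n} (cs : Vec ℤ n) (L : Vec Sign n) → VAll.All (_≡ 0ℤ) (cs ⊕ map val L) →
    VAll.All InSmall cs × map balance cs ≡ L
  recover []       []      []       = [] , refl
  recover (c ∷ cs) (s ∷ L) (e ∷ es) =
    let small , bal = balance-recovers c s e ; smalls , bals = recover cs L es
    in (small ∷ smalls) , cong₂ _∷_ bal bals
  good-I : ColumnGood I
  good-I = proj₁ (recover (colSums I) L zero-sums)
  last-forced : map balance (colSums I) ≡ L
  last-forced = proj₂ (recover (colSums I) L zero-sums)
  rows-I : rowSums I ≡ r
  rows-I = VP.∷ʳ-injectiveˡ (rowSums I) r (trans (sym (VP.map-∷ʳ rowSum L I)) rows)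

A-≡ : ∀ {k n} {r : Vec ℤ k} {x y : A r n} → proj₁ x ≡ proj₁ y → x ≡ y
A-≡ {x = M , p , q} {.M , p′ , q′} refl =
  cong₂ (λ a b → M , a , b) (≡-irrelevant p p′) (VAll.irrelevant InSmall-irrelevant q q′)
  where
  InSmall-irrelevant : ∀ {z} (a b : InSmall z) → a ≡ b
  InSmall-irrelevant is-1 is-1 = refl
  InSmall-irrelevant is0  is0  = refl
  InSmall-irrelevant is1  is1  = refl

completion-bijection : ∀ {k} n (r : Vec ℤ k) → odd k ≡ true → A r n ⤖ A (extend r) n
completion-bijection {k} n r k-odd = ↔⇒⤖ (mk↔ₛ′ to from to∘from from∘to)
  where
  k+1-even : odd (suc k) ≡ false
  k+1-even = cong not k-odd
  to : A r n → A (extend r) n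
  to (M , h) = complete M , complete-good r k-odd M h
  from : A (extend r) n → A r n
  from (M , p , q) = init M , proj₁ (uncomplete-good r k+1-even M p q)
  to∘from : ∀ y → to (from y) ≡ y
  to∘from (M , p , q) = A-≡ (proj₂ (uncomplete-good r k+1-even M p q))
  from∘to : ∀ x → from (to x) ≡ x
  from∘to (M , h) = A-≡ (VP.init-∷ʳ _ M)

count-transfer : ∀ {X Y : Set} {P : X → Set} {Q : Y → Set} (P? : Decidable P) (Q? : Decidable Q)
  (f : X → Y) → Injective _≡_ _≡_ f → (∀ {x} → P x → Q (f x)) →
  (∀ {y} → Q y → ∃ λ x → P x × f x ≡ y) →
  {xs : List X} {ys : List Y} → Unique xs → Unique ys → (∀ x → x ∈ xs) → (∀ y → y ∈ ys) →
  length (filter P? xs) ≡ length (filter Q? ys)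
count-transfer P? Q? f f-inj preserves covers {xs} {ys} xs-unique ys-unique xs-all ys-all =
  trans (sym (LP.length-map f (filter P? xs))) (↭-length (∼bag⇒↭ same-bag))
  where
  same-elements : ∀ {y} → y ∈ L.map f (filter P? xs) → y ∈ filter Q? ys
  same-elements y∈ with ∈.∈-map⁻ f y∈
  ... | x , x∈ , refl = ∈.∈-filter⁺ Q? (ys-all (f x)) (preserves (proj₂ (∈.∈-filter⁻ P? {xs = xs} x∈)))
  covered : ∀ {y} → y ∈ filter Q? ys → y ∈ L.map f (filter P? xs)
  covered y∈ with covers (proj₂ (∈.∈-filter⁻ Q? {xs = ys} y∈))
  ... | x , px , refl = ∈.∈-map⁺ f (∈.∈-filter⁺ P? (xs-all x) px)
  same-bag : L.map f (filter P? xs) ∼[ bag ] filter Q? ys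
  same-bag = unique∧set⇒bag (Unique.map⁺ f-inj (Unique.filter⁺ P? xs-unique))
    (Unique.filter⁺ Q? ys-unique) (mk⇔ same-elements covered)

concatMap-map : ∀ {X Y W : Set} (f : X → Y → W) xs ys →
  L.concatMap (λ x → L.map (f x) ys) xs ≡ L.cartesianProductWith f xs ys
concatMap-map f L.[]       ys = refl
concatMap-map f (x L.∷ xs) ys = cong (L.map (f x) ys L.++_) (concatMap-map f xs ys)

allVecs-complete : ∀ {n} (v : Vec Sign n) → v ∈ allVecs n
allVecs-complete []      = Any.here refl
allVecs-complete (s ∷ v) = ∈.∈-concatMap⁺ (λ v′ → L.map (_∷ v′) signs)
  (Any.map (λ { refl → sign∈ s }) (allVecs-complete v))
  where
  signs : List Sign
  signs = plus L.∷ minus L.∷ L.[]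
  sign∈ : ∀ s → (s ∷ v) ∈ L.map (_∷ v) signs
  sign∈ plus  = Any.here refl
  sign∈ minus = Any.there (Any.here refl)

allVecs-unique : ∀ n → Unique (allVecs n)
allVecs-unique zero    = LAll.[] ∷ []
allVecs-unique (suc n) = subst Unique (sym (concatMap-map (λ v s → s ∷ v) (allVecs n) _))
  (Unique.cartesianProductWith⁺ (λ v s → s ∷ v) (λ { refl → refl , refl }) (allVecs-unique n)
    (((λ ()) LAll.∷ LAll.[]) ∷ LAll.[] ∷ []))

allMatrices-complete : ∀ {k n} (M : Matrix k n) → M ∈ allMatrices k n
allMatrices-complete []      = Any.here refl
allMatrices-complete {n = n} (x ∷ M) = ∈.∈-concatMap⁺ (λ M′ → L.map (_∷ M′) (allVecs n))
  (Any.map (λ { refl → ∈.∈-map⁺ (_∷ M) (allVecs-complete x) }) (allMatrices-complete M))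

allMatrices-unique : ∀ k n → Unique (allMatrices k n)
allMatrices-unique zero    n = LAll.[] ∷ []
allMatrices-unique (suc k) n = subst Unique (sym (concatMap-map (λ M v → v ∷ M) (allMatrices k n) _))
  (Unique.cartesianProductWith⁺ (λ M v → v ∷ M) (λ { refl → refl , refl })
    (allMatrices-unique k n) (allVecs-unique n))

mainTheorem13 : (k : ℕ) → suc k ≥ 2 → (Σ ℕ λ j → suc k ≡ 2 * j) → (n : ℕ) → n ≥ 1
    → (r : Vec ℤ k)
    → (A r n ⤖ A (extend r) n) × (α r n ≡ α (extend r) n)
mainTheorem13 k _ (j , k+1≡2j) n _ r = completion-bijection n r k-odd , counts-equal
  where
  k+1-even : odd (suc k) ≡ false
  k+1-even = trans (cong odd k+1≡2j) (odd-double j)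
  k-odd : odd k ≡ true
  k-odd = trans (sym (not-involutive (odd k))) (cong not k+1-even)
  counts-equal : α r n ≡ α (extend r) n
  counts-equal = count-transfer (inA? r) (inA? (extend r)) complete complete-injective
    (complete-good r k-odd _)
    (λ {M} (p , q) → init M , uncomplete-good r k+1-even M p q)
    (allMatrices-unique k n) (allMatrices-unique (suc k) n)
    allMatrices-complete allMatrices-complete
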